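{- Let $\mathcal{J}=\{1,\ldots,n\}$ be a set of jobs indexed so that $p_1\le\cdots\le p_n$, with tied jobs ordered by non-decreasing weight, let $i_1<\cdots<i_\ell$ be its key sequence, let $\mathcal{S}_{\mathrm{key}}$ be the synchronized schedule $(i_1,\ldots,i_\ell)$, and let $u^*=\sum_{k=1}^{\ell}w_{i_k}(p_{i_k}-p_{i_{k-1}})$ with $p_{i_0}=0$. Then $2\,W(\mathcal{S}_{\mathrm{key}})\ge u^*$, where $W$ denotes total weighted overlap.
   Context: Weighted Single-Processor Scheduling: job $j$ has processing time $p_j>0$ and weight $w_j\ge0$, its own private processor $\mathcal{P}_j$, and there is one shared processor $\mathcal{M}$. A feasible schedule: each job $j$ executes on $\mathcal{P}_j$ in a single interval $(0,C_j^{\mathcal{P}})$ and on $\mathcal{M}$ in a (possibly empty) collection $\mathcal{I}_j$ of open intervals, with $C_j^{\mathcal{P}}+\sum_{I\in\mathcal{I}_j}|I|=p_j$, and all intervals on $\mathcal{M}$ pairwise disjoint. The total overlap $t_j$ is the total time $j$ executes simultaneously on $\mathcal{P}_j$ and $\mathcal{M}$; the total weighted overlap is $W(\mathcal{S})=\sum_j t_jw_j$. For a sequence $(j_1,\ldots,j_k)$ of distinct jobs, the synchronized schedule $(j_1,\ldots,j_k)$ lets $j_i$ execute on $\mathcal{M}$ exactly in $(S_i,C_i)$ where $C_0=0$, $S_i=C_{i-1}$, $C_i=(p_{j_i}+S_i)/2$, and on $\mathcal{P}_{j_i}$ in $(0,C_i)$; other jobs run only on their private processors. Key sequence: $1\le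 i_1<\cdots<i_\ell\le n$ with (i) $i_\ell=n$; (ii) $w_{i_1}>\cdots>w_{i_\ell}$; (iii) $w_k\le w_{i_j}$ for each $j\in\{1,\ldots,\ell\}$ and $k\in\{i_{j-1}+1,\ldots,i_j\}$, where $i_0=0$ (it exists and is unique). The quantity $u^*$ is the area of the step function (upper envelope) equal to $w_{i_k}$ on $(p_{i_{k-1}},p_{i_k}]$.
   Formalization: The processing times $p_j$ and the weights $w_j$ are rational. -}

module Defs where

open import Data.Nat as ℕ using (ℕ; suc; _∸_)
open import Data.Fin using (Fin; toℕ)
open import Data.List using (List; []; _∷_)
open import Data.Product using (_×_; _,_)
open import Data.Empty using (⊥)
open import Data.Rational using (ℚ; 0ℚ; ½; _+_; _-_; _*_; _⊔_; _⊓_; _≤_; _<_)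
open import Relation.Binary.PropositionalEquality using (_≡_)

-- Jobs are indexed by Fin n (0-based: paper's job i is Fin index i-1).
-- p j = processing time, w j = weight (rational-valued).

SortedJobs : {n : ℕ} → (p w : Fin n → ℚ) → Set
SortedJobs {n} p w =
  (∀ (j k : Fin n) → toℕ j ℕ.< toℕ k → p j ≤ p k) ×
  (∀ (j k : Fin n) → toℕ j ℕ.< toℕ k → p j ≡ p k → w j ≤ w k)

-- Key sequence conditions, with lo = (0-based) index of the first job of the
-- current block {i_{j-1}+1, ..., i_j}.
KeySeqFrom : {n : ℕ} → (w : Fin n → ℚ) → ℕ → List (Fin n) → Set
KeySeqFrom w lo [] = ⊥
KeySeqFrom {n} w lo (i ∷ []) =
  (toℕ i ≡ n ∸ 1) ×
  (∀ (k : Fin n) → lo ℕ.≤ toℕ k → toℕ k ℕ.≤ toℕ i → w k ≤ w i)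
KeySeqFrom {n} w lo (i ∷ j ∷ rest) =
  (toℕ i ℕ.< toℕ j) ×
  (w j < w i) ×
  (∀ (k : Fin n) → lo ℕ.≤ toℕ k → toℕ k ℕ.≤ toℕ i → w k ≤ w i) ×
  KeySeqFrom w (suc (toℕ i)) (j ∷ rest)

IsKeySequence : {n : ℕ} → (w : Fin n → ℚ) → List (Fin n) → Set
IsKeySequence w ks = KeySeqFrom w 0 ks

-- Synchronized schedule: from S (= C_{i-1}) produce entries (job, S_i, C_i).
syncFrom : {n : ℕ} → (p : Fin n → ℚ) → ℚ → List (Fin n) → List (Fin n × ℚ × ℚ)
syncFrom p s [] = []
syncFrom p s (j ∷ js) = (j , s , c) ∷ syncFrom p c js
  where c = (p j + s) * ½

synchronized : {n : ℕ} → (p : Fin n → ℚ) → List (Fin n) → List (Fin n × ℚ × ℚ)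
synchronized p js = syncFrom p 0ℚ js

overlapLen : ℚ → ℚ → ℚ → ℚ → ℚ
overlapLen a b c d = 0ℚ ⊔ ((b ⊓ d) - (a ⊔ c))

-- Total weighted overlap: job j runs on M in (S,C) and on its private
-- processor in (0,C); jobs not in the sequence have no overlap.
weightedOverlap : {n : ℕ} → (w : Fin n → ℚ) → List (Fin n × ℚ × ℚ) → ℚ
weightedOverlap w [] = 0ℚ
weightedOverlap w ((j , s , c) ∷ rest) =
  w j * overlapLen s c 0ℚ c + weightedOverlap w rest

ustarFrom : {n : ℕ} → (p w : Fin n → ℚ) → ℚ → List (Fin n) → ℚ
ustarFrom p w prev [] = 0ℚ
ustarFrom p w prev (i ∷ is) = w i * (p i - prev) + ustarFrom p w (p i) is

ustar : {n : ℕ} → (p w : Fin n → ℚ) → List (Fin n) → ℚ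
ustar p w ks = ustarFrom p w 0ℚ ks

{-# OPTIONS --safe #-}
-- In the synchronized schedule job i_k runs on the shared processor during
-- (C_{k-1}, C_k), where C_k is the midpoint of C_{k-1} and p_{i_k}; so its
-- overlap is exactly (p_{i_k} - C_{k-1}) / 2. Inductively C_{k-1} lies between
-- 0 and p_{i_{k-1}}, hence twice the overlap of i_k is at least
-- p_{i_k} - p_{i_{k-1}}. Multiplying by w_{i_k} >= 0 and summing gives the
-- bound. Of the key-sequence conditions only i_1 < ... < i_l is needed, which
-- makes p nondecreasing along the sequence.
module Submission where

open import Defs
open import Data.Nat as ℕ using (ℕ)
open import Data.Fin using (Fin; toℕ)
open import Data.List using (List; []; _∷_; map)
open import Data.List.Relation.Unary.Linked using (Linked; [-]; _∷_)
open import Data.Integer using (+_)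
open import Data.Rational
  using (ℚ; 0ℚ; ½; _≤_; _<_; _+_; _-_; _*_; _/_; _⊔_; _⊓_; nonNegative)
open import Data.Rational.Properties
open import Data.Rational.Solver using (module +-*-Solver)
open import Data.Product using (_,_)
open import Relation.Binary.PropositionalEquality using (_≡_; refl; cong₂)

open +-*-Solver

two : ℚ
two = + 2 / 1

[p+p]*½≡p : ∀ p → (p + p) * ½ ≡ p
[p+p]*½≡p = solve 1 (λ p → (p :+ p) :* con ½ := p) refl

[p+q]*½≤p : ∀ {p q} → q ≤ p → (p + q) * ½ ≤ p
[p+q]*½≤p {p} {q} q≤p = begin
  (p + q) * ½  ≤⟨ *-monoʳ-≤-nonNeg ½ (+-monoʳ-≤ p q≤p) ⟩
  (p + p) * ½  ≡⟨ [p+p]*½≡p p ⟩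
  p            ∎
  where open ≤-Reasoning

q≤[p+q]*½ : ∀ {p q} → q ≤ p → q ≤ (p + q) * ½
q≤[p+q]*½ {p} {q} q≤p = begin
  q            ≡⟨ [p+p]*½≡p q ⟨
  (q + q) * ½  ≤⟨ *-monoʳ-≤-nonNeg ½ (+-monoˡ-≤ q q≤p) ⟩
  (p + q) * ½  ∎
  where open ≤-Reasoning

b-a≤overlapLen[a,b][0,b] : ∀ {a} b → 0ℚ ≤ a → b - a ≤ overlapLen a b 0ℚ b
b-a≤overlapLen[a,b][0,b] {a} b 0≤a = begin
  b - a              ≡⟨ cong₂ _-_ (⊓-idem b) (p≥q⇒p⊔q≡p 0≤a) ⟨
  b ⊓ b - (a ⊔ 0ℚ)   ≤⟨ p≤q⊔p 0ℚ _ ⟩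
  overlapLen a b 0ℚ b ∎
  where open ≤-Reasoning

a-r≤2*synchronizedOverlap : ∀ a {s r} → 0ℚ ≤ s → s ≤ r →
  a - r ≤ two * overlapLen s ((a + s) * ½) 0ℚ ((a + s) * ½)
a-r≤2*synchronizedOverlap a {s} {r} 0≤s s≤r = begin
  a - r                        ≤⟨ +-monoʳ-≤ a (neg-antimono-≤ s≤r) ⟩
  a - s                        ≡⟨ solve 2 (λ a s → a :- s := con two :* ((a :+ s) :* con ½ :- s)) refl a s ⟩
  two * (c - s)                ≤⟨ *-monoˡ-≤-nonNeg two (b-a≤overlapLen[a,b][0,b] c 0≤s) ⟩
  two * overlapLen s c 0ℚ c    ∎
  where
  open ≤-Reasoning
  c = (a + s) * ½

module _ {n : ℕ} (p w : Fin n → ℚ) (w≥0 : ∀ j → 0ℚ ≤ w j) where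

  -- prev is the processing time of the preceding key job, s the start time of
  -- the next job on the shared processor.
  ustarFrom≤2*weightedOverlap : ∀ {s prev} ks → 0ℚ ≤ s → s ≤ prev →
    Linked _≤_ (prev ∷ map p ks) →
    ustarFrom p w prev ks ≤ two * weightedOverlap w (syncFrom p s ks)
  ustarFrom≤2*weightedOverlap [] _ _ _ = ≤-refl
  ustarFrom≤2*weightedOverlap {s} {prev} (i ∷ is) 0≤s s≤prev (prev≤pᵢ ∷ ascending) = begin
    w i * (p i - prev) + ustarFrom p w (p i) is
      ≤⟨ +-mono-≤ head≤ tail≤ ⟩
    w i * (two * tᵢ) + two * W
      ≡⟨ solve 3 (λ x o W → x :* (con two :* o) :+ con two :* W := con two :* (x :* o :+ W)) refl (w i) tᵢ W ⟩
    two * (w i * tᵢ + W) ∎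
    where
    open ≤-Reasoning
    c = (p i + s) * ½
    tᵢ = overlapLen s c 0ℚ c
    W = weightedOverlap w (syncFrom p c is)
    s≤pᵢ = ≤-trans s≤prev prev≤pᵢ
    head≤ : w i * (p i - prev) ≤ w i * (two * tᵢ)
    head≤ = *-monoˡ-≤-nonNeg (w i) {{nonNegative (w≥0 i)}} (a-r≤2*synchronizedOverlap (p i) 0≤s s≤prev)
    tail≤ : ustarFrom p w (p i) is ≤ two * W
    tail≤ = ustarFrom≤2*weightedOverlap is (≤-trans 0≤s (q≤[p+q]*½ s≤pᵢ)) ([p+q]*½≤p s≤pᵢ) ascending

keySequence⇒ascending : ∀ {n} {p w : Fin n → ℚ} →
  (∀ (j k : Fin n) → toℕ j ℕ.< toℕ k → p j ≤ p k) →
  ∀ {lo} ks → KeySeqFrom w lo ks → Linked _≤_ (map p ks)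
keySequence⇒ascending p-mono (i ∷ [])     _                 = [-]
keySequence⇒ascending p-mono (i ∷ j ∷ ks) (i<j , _ , _ , K) =
  p-mono i j i<j ∷ keySequence⇒ascending p-mono (j ∷ ks) K

lemma2 : (n : ℕ) (p w : Fin n → ℚ) →
    (∀ j → 0ℚ < p j) → (∀ j → 0ℚ ≤ w j) →
    SortedJobs p w →
    (ks : List (Fin n)) → IsKeySequence w ks →
    ustar p w ks ≤ (+ 2 / 1) * weightedOverlap w (synchronized p ks)
lemma2 n p w p>0 w≥0 (p-mono , _) ks@(i ∷ _) K =
  ustarFrom≤2*weightedOverlap p w w≥0 ks ≤-refl ≤-refl
    (<⇒≤ (p>0 i) ∷ keySequence⇒ascending p-mono ks K)
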